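{- Let $n\ge8$, let $\ell\in\{1,\dots,\lfloor n/4\rfloor-1\}$, and let $\mathbf{a}\in\mathcal{S}_1$ and $\mathbf{b}\in\mathcal{S}_2$. Then $\mathfrak{B}_\ell\cup\{\mathbf{a},\mathbf{b}\}$ is a linearly independent set (of $2n+1$ vectors in $\mathbb{R}^{2n+1}$).
   Context: For $1 \le i,j \le n$ let $\mathbf{c}_{i,j} \in \mathbb{R}^{2n+1}$ be the vector whose $k$-th coordinate ($1\le k\le n$) is $1$ if $k=i$ and $0$ otherwise, whose $(n+k)$-th coordinate ($1 \le k \le n-1$) is $1$ if $k=j$ and $0$ otherwise, whose $2n$-th coordinate is $1$ if $i=j$ and $0$ otherwise, and whose $(2n+1)$-th coordinate is $1$ if $i+j=n+1$ and $0$ otherwise. The second subscript is read modulo $n$: $\mathbf{c}_{i,j+mn}=\mathbf{c}_{i,j}$. Let $\mathcal{S}_1=\{\mathbf{c}_{i,i}:1\le i\le n\}$ and $\mathcal{S}_2=\{\mathbf{c}_{i,n+1-i}:1\le i\le n\}\setminus\mathcal{S}_1$. Let $\epsilon(n)=1$ if $n$ is even and $0$ if $n$ is odd, and $N=\frac{n-1+\epsilon(n)}{2}-2$. For $0\le\ell\le N$ let $\widetilde{\mathfrak{B}}_\ell=\{\mathbf{c}_{i,i+2\ell}:1\le i\le n\}\cup(\{\mathbf{c}_{i,i+2\ell+1}:1\le i\le n\}\setminus\{\mathbf{c}_{n-2\ell-1,n}\})$. For $1\le\ell\le N$ let $i_1=i_1(\ell)=\frac{n+1-\epsilon(n)}{2}-\ell$,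 $i_2=i_2(\ell)=n-\ell$, and $$\mathfrak{B}_\ell=\Big(\widetilde{\mathfrak{B}}_\ell\setminus\{\mathbf{c}_{i_1,i_1+2\ell},\mathbf{c}_{i_1,i_1+2\ell+1},\mathbf{c}_{i_2,i_2+2\ell},\mathbf{c}_{i_2,i_2+2\ell+1}\}\Big)\cup\{\mathbf{c}_{i_1,i_2+2\ell},\mathbf{c}_{i_1,i_2+2\ell+1},\mathbf{c}_{i_2,i_1+2\ell},\mathbf{c}_{i_2,i_1+2\ell+1}\}.$$
   Formalization: Stated over the rationals: the vectors lie in ℚ^(2n+1) and linear independence uses rational coefficients, rather than $\mathbb{R}^{2n+1}$ and real coefficients. -}

module Defs where

open import Data.Nat using (ℕ; zero; suc; _+_; _*_; _∸_; _<ᵇ_; _≡ᵇ_; _%_; _/_; _≤_)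
open import Data.Bool using (Bool; true; false; if_then_else_)
open import Data.Fin using (Fin; toℕ)
open import Data.Vec using (Vec; []; _∷_; tabulate; replicate; zipWith; map)
open import Data.List using (List; []; _∷_; length)
open import Data.List.Relation.Unary.All using (All)
open import Data.List.Relation.Unary.Unique.Propositional using (Unique)
open import Data.Rational using (ℚ; 0ℚ; 1ℚ) renaming (_+_ to _+ℚ_; _*_ to _*ℚ_)
open import Data.Product using (Σ; _×_; ∃)
open import Data.Sum using (_⊎_)
open import Relation.Binary.PropositionalEquality using (_≡_; _≢_)
open import Relation.Nullary using (¬_)
open import Function.Bundles using (_⇔_)
open import Level using (0ℓ)
import Data.Vec.Membership.Propositional as VM
import Data.Vec.Relation.Unary.Unique.Propositional as VU

dim : ℕ → ℕ
dim n = 2 * n + 1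

-- the vectors of R^{2n+1} considered here (all entries rational)
Vecn : ℕ → Set
Vecn n = Vec ℚ (dim n)

-- reduction of the second subscript modulo n into the range {1,…,n}
-- (for n ≥ 1 and j ≥ 1: red n j ≡ j (mod n) and 1 ≤ red n j ≤ n)
red : ℕ → ℕ → ℕ
red n j = suc ((j ∸ 1) % suc (n ∸ 1))

ind : Bool → ℚ
ind b = if b then 1ℚ else 0ℚ

-- coordinate with 0-based index k0 (paper's coordinate k0+1) of c_{i,j},
-- where j is already in {1,…,n}
coord : ℕ → ℕ → ℕ → ℕ → ℚ
coord n i j k0 =
  if k0 <ᵇ n then ind (suc k0 ≡ᵇ i)
  else if k0 <ᵇ (2 * n ∸ 1) then ind (j ≡ᵇ (suc k0 ∸ n))
  else if k0 ≡ᵇ (2 * n ∸ 1) then ind (i ≡ᵇ j)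
  else ind ((i + j) ≡ᵇ suc n)

c : (n i j : ℕ) → Vecn n
c n i j = tabulate (λ k → coord n i (red n j) (toℕ k))

VSet : ℕ → Set₁
VSet n = Vecn n → Set

InRange : ℕ → ℕ → Set
InRange n i = 1 ≤ i × i ≤ n

S₁ : (n : ℕ) → VSet n
S₁ n v = ∃ λ i → InRange n i × v ≡ c n i i

S₂ : (n : ℕ) → VSet n
S₂ n v = (∃ λ i → InRange n i × v ≡ c n i (suc n ∸ i)) × ¬ S₁ n v

Bt : (n ℓ : ℕ) → VSet n
Bt n ℓ v =
  (∃ λ i → InRange n i × v ≡ c n i (i + 2 * ℓ))
  ⊎ ((∃ λ i → InRange n i × v ≡ c n i (i + 2 * ℓ + 1))
     × v ≢ c n (n ∸ 2 * ℓ ∸ 1) n)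

ε : ℕ → ℕ
ε n = if n % 2 ≡ᵇ 0 then 1 else 0

i₁ : ℕ → ℕ → ℕ
i₁ n ℓ = (n + 1 ∸ ε n) / 2 ∸ ℓ

i₂ : ℕ → ℕ → ℕ
i₂ n ℓ = n ∸ ℓ

B : (n ℓ : ℕ) → VSet n
B n ℓ v =
  (Bt n ℓ v
    × v ≢ c n (i₁ n ℓ) (i₁ n ℓ + 2 * ℓ)
    × v ≢ c n (i₁ n ℓ) (i₁ n ℓ + 2 * ℓ + 1)
    × v ≢ c n (i₂ n ℓ) (i₂ n ℓ + 2 * ℓ)
    × v ≢ c n (i₂ n ℓ) (i₂ n ℓ + 2 * ℓ + 1))
  ⊎ (v ≡ c n (i₁ n ℓ) (i₂ n ℓ + 2 * ℓ)
    ⊎ v ≡ c n (i₁ n ℓ) (i₂ n ℓ + 2 * ℓ + 1)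
    ⊎ v ≡ c n (i₂ n ℓ) (i₁ n ℓ + 2 * ℓ)
    ⊎ v ≡ c n (i₂ n ℓ) (i₁ n ℓ + 2 * ℓ + 1))

lincomb : {d : ℕ} → List ℚ → List (Vec ℚ d) → Vec ℚ d
lincomb {d} (a ∷ as) (v ∷ vs) = zipWith _+ℚ_ (map (a *ℚ_) v) (lincomb as vs)
lincomb {d} _ _ = replicate d 0ℚ

LinearlyIndependent : {d : ℕ} → (Vec ℚ d → Set) → Set
LinearlyIndependent {d} S =
  (vs : List (Vec ℚ d)) → Unique vs → All S vs →
  (cs : List ℚ) → length cs ≡ length vs →
  lincomb cs vs ≡ replicate d 0ℚ → All (_≡ 0ℚ) cs

HasCardinality : {d : ℕ} → (Vec ℚ d → Set) → ℕ → Set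
HasCardinality {d} S m =
  Σ (Vec (Vec ℚ d) m) λ es → VU.Unique es × ((v : Vec ℚ d) → S v ⇔ v VM.∈ es)

BUab : (n ℓ : ℕ) → Vecn n → Vecn n → VSet n
BUab n ℓ a b v = B n ℓ v ⊎ v ≡ a ⊎ v ≡ b

{-# OPTIONS --safe #-}
-- List the 2n + 1 vectors as a, b and then the vectors of 𝔅_ℓ column by column, from
-- column n - 1 down to column 1 and finally column n. With ρ(j) = σ(j - 2ℓ mod n), where σ
-- swaps the rows i₁ and i₂, column j < n contributes c_{ρ(j), j} and c_{ρ(j-1), j}, and
-- column n only c_{ρ(n), n}; the missing c_{ρ(n-1), n} is the vector removed from 𝔅̃_ℓ.
-- Every vector then has a coordinate equal to 1 on which all later vectors vanish: its row
-- for c_{ρ(j), j}, its column for c_{ρ(j-1), j}, the diagonal coordinate for a and the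
-- antidiagonal one for b. Such an echelon list is linearly independent and has no
-- repetitions. The pivots need ρ to be injective and the cells (σ(i), i + 2ℓ) and
-- (σ(i), i + 2ℓ + 1) to avoid the diagonal and the antidiagonal; without σ, a parity
-- argument shows that the antidiagonal is hit exactly in the rows i₁ and i₂, and swapping
-- these two rows moves the cells off it.
module Submission where

open import Defs
open import Data.Nat using (ℕ; zero; suc; _≤_; _<_; _/_; _%_; _∸_; _+_; _*_; z≤n; s≤s; z<s; _≡ᵇ_; _<ᵇ_)
open import Data.Nat.DivMod
  using (m≤n⇒m%n≡m; m%n<n; %-distribˡ-+; m%n%n≡m%n; [m+n]%n≡m%n; [m+kn]%n≡m%n; m*n%n≡0; m*n/n≡m; m/n*n≤m; m≡m%n+[m/n]*n)
open import Data.Nat.Properties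
open import Data.Nat.Tactic.RingSolver using (solve; solve-∀)
open import Data.Bool using (true; false; T; if_then_else_)
open import Data.Bool.Properties using (T-≡; if-cong)
open import Data.Unit using (tt)
open import Data.Fin using (Fin; fromℕ<; toℕ)
open import Data.Fin.Properties using (toℕ-fromℕ<)
open import Data.Product using (∃; _×_; _,_; proj₁; proj₂)
open import Data.Sum using (_⊎_; inj₁; inj₂; [_,_]′)
open import Data.Empty using (⊥-elim)
open import Data.Vec using (Vec; []; _∷_; lookup; replicate; map; tabulate)
open import Data.Vec.Properties using (lookup-zipWith; lookup-map; lookup-replicate; lookup∘tabulate)
import Data.Vec.Relation.Unary.All as VecAll
open import Data.Vec.Relation.Unary.Any using (here; there)
import Data.Vec.Membership.Propositional as VecMembership
import Data.Vec.Relation.Unary.AllPairs as VecAllPairs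
open import Data.List using (List; []; _∷_; length)
open import Data.List.Relation.Unary.All using (All; []; _∷_)
open import Data.List.Relation.Unary.AllPairs using ([]; _∷_)
open import Data.List.Relation.Unary.Unique.Propositional using (Unique)
open import Data.List.Relation.Binary.Pointwise using (Pointwise; []; _∷_)
import Data.List.Relation.Binary.Pointwise as Pointwise
import Data.Vec.Relation.Unary.Unique.Propositional as VecUnique
open import Data.Rational using (ℚ; 0ℚ; 1ℚ) renaming (_+_ to _+ℚ_; _*_ to _*ℚ_)
import Data.Rational.Properties as ℚ
open import Relation.Binary.PropositionalEquality
open import Relation.Nullary using (¬_; yes; no)
open import Function.Bundles using (_⇔_; Equivalence; mk⇔)
open import Function.Base using (_∘_; case_of_)

open VecMembership using (_∈_)

-- Echelon lists of vectors

module _ {d : ℕ} where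

  PivotOver : ∀ {N} → Vec ℚ d → Vec (Vec ℚ d) N → Set
  PivotOver w W = ∃ λ k → lookup w k ≡ 1ℚ × VecAll.All (λ u → lookup u k ≡ 0ℚ) W

  data Echelon : ∀ {N} → Vec (Vec ℚ d) N → Set where
    [] : Echelon []
    _∷_ : ∀ {N w} {W : Vec (Vec ℚ d) N} → PivotOver w W → Echelon W → Echelon (w ∷ W)

  lookup-lincomb-∷ : ∀ c cs (v : Vec ℚ d) vs k →
    lookup (lincomb (c ∷ cs) (v ∷ vs)) k ≡ c *ℚ lookup v k +ℚ lookup (lincomb cs vs) k
  lookup-lincomb-∷ c cs v vs k =
    trans (lookup-zipWith _+ℚ_ k (map (c *ℚ_) v) (lincomb cs vs))
          (cong (_+ℚ lookup (lincomb cs vs) k) (lookup-map k (c *ℚ_) v))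

  lookup-lincomb-tail : ∀ c cs (v : Vec ℚ d) vs k → c *ℚ lookup v k ≡ 0ℚ →
    lookup (lincomb (c ∷ cs) (v ∷ vs)) k ≡ lookup (lincomb cs vs) k
  lookup-lincomb-tail c cs v vs k head=0 =
    trans (lookup-lincomb-∷ c cs v vs k)
          (trans (cong (_+ℚ lookup (lincomb cs vs) k) head=0) (ℚ.+-identityˡ _))

  lookup-lincomb-≡0 : ∀ {cs} {vs : List (Vec ℚ d)} k →
    Pointwise (λ c v → c *ℚ lookup v k ≡ 0ℚ) cs vs → lookup (lincomb cs vs) k ≡ 0ℚ
  lookup-lincomb-≡0 k [] = lookup-replicate k 0ℚ
  lookup-lincomb-≡0 {c ∷ cs} {v ∷ vs} k (p ∷ ps) =
    trans (lookup-lincomb-tail c cs v vs k p) (lookup-lincomb-≡0 k ps)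

  contribution-vanishes : ∀ {N k c v} {W : Vec (Vec ℚ d) N} →
    VecAll.All (λ u → lookup u k ≡ 0ℚ) W → c ≡ 0ℚ ⊎ v ∈ W → c *ℚ lookup v k ≡ 0ℚ
  contribution-vanishes {k = k} {v = v} _ (inj₁ refl) = ℚ.*-zeroˡ (lookup v k)
  contribution-vanishes {c = c} Wk=0 (inj₂ v∈W) =
    trans (cong (c *ℚ_) (VecAll.lookup Wk=0 v∈W)) (ℚ.*-zeroʳ c)

  -- At coordinate k only the occurrence of w (unique, as vs is) contributes to the sum.
  pivot-coefficient-vanishes : ∀ {N w k} {W : Vec (Vec ℚ d) N} {cs vs} →
    lookup w k ≡ 1ℚ → VecAll.All (λ u → lookup u k ≡ 0ℚ) W → Unique vs →
    Pointwise (λ c v → c ≡ 0ℚ ⊎ v ∈ w ∷ W) cs vs → lookup (lincomb cs vs) k ≡ 0ℚ →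
    Pointwise (λ c v → c ≡ 0ℚ ⊎ v ∈ W) cs vs
  pivot-coefficient-vanishes _ _ _ [] _ = []
  pivot-coefficient-vanishes {k = k} {cs = c ∷ cs} {v ∷ vs} wk=1 Wk=0 (_ ∷ unique)
    (inj₁ c≡0 ∷ ps) sum=0 =
    inj₁ c≡0 ∷ pivot-coefficient-vanishes wk=1 Wk=0 unique ps
      (trans (sym (lookup-lincomb-tail c cs v vs k (contribution-vanishes {c = c} {v} Wk=0 (inj₁ c≡0))))
             sum=0)
  pivot-coefficient-vanishes {k = k} {cs = c ∷ cs} {v ∷ vs} wk=1 Wk=0 (_ ∷ unique)
    (inj₂ (there v∈W) ∷ ps) sum=0 =
    inj₂ v∈W ∷ pivot-coefficient-vanishes wk=1 Wk=0 unique ps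
      (trans (sym (lookup-lincomb-tail c cs v vs k (contribution-vanishes {c = c} {v} Wk=0 (inj₂ v∈W))))
             sum=0)
  pivot-coefficient-vanishes {w = w} {k} {W} {c ∷ cs} {v ∷ vs} wk=1 Wk=0 (v∉vs ∷ _)
    (inj₂ (here v≡w) ∷ ps) sum=0 = inj₁ c≡0 ∷ rest
    where
      drop-w : ∀ {cs′ vs′} → All (λ u → ¬ v ≡ u) vs′ →
        Pointwise (λ c v → c ≡ 0ℚ ⊎ v ∈ w ∷ W) cs′ vs′ →
        Pointwise (λ c v → c ≡ 0ℚ ⊎ v ∈ W) cs′ vs′
      drop-w _ [] = []
      drop-w (_ ∷ ne) (inj₁ c≡0 ∷ ps′) = inj₁ c≡0 ∷ drop-w ne ps′
      drop-w (v≢u ∷ _) (inj₂ (here u≡w) ∷ _) = ⊥-elim (v≢u (trans v≡w (sym u≡w)))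
      drop-w (_ ∷ ne) (inj₂ (there u∈W) ∷ ps′) = inj₂ u∈W ∷ drop-w ne ps′
      rest = drop-w v∉vs ps
      c≡0 : c ≡ 0ℚ
      c≡0 = begin
        c                                            ≡⟨ ℚ.*-identityʳ c ⟨
        c *ℚ 1ℚ                                      ≡⟨ cong (c *ℚ_) (trans (cong (λ u → lookup u k) v≡w) wk=1) ⟨
        c *ℚ lookup v k                              ≡⟨ ℚ.+-identityʳ _ ⟨
        c *ℚ lookup v k +ℚ 0ℚ                        ≡⟨ cong (c *ℚ lookup v k +ℚ_) tail=0 ⟨
        c *ℚ lookup v k +ℚ lookup (lincomb cs vs) k  ≡⟨ lookup-lincomb-∷ c cs v vs k ⟨
        lookup (lincomb (c ∷ cs) (v ∷ vs)) k         ≡⟨ sum=0 ⟩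
        0ℚ                                           ∎
        where
          open ≡-Reasoning
          tail=0 = lookup-lincomb-≡0 k (Pointwise.map (contribution-vanishes Wk=0) rest)

  echelon-coefficients-vanish : ∀ {N} {W : Vec (Vec ℚ d) N} {cs vs} → Echelon W → Unique vs →
    Pointwise (λ c v → c ≡ 0ℚ ⊎ v ∈ W) cs vs → lincomb cs vs ≡ replicate d 0ℚ →
    Pointwise (λ c _ → c ≡ 0ℚ) cs vs
  echelon-coefficients-vanish [] _ ps _ = Pointwise.map (λ { (inj₁ c≡0) → c≡0 ; (inj₂ ()) }) ps
  echelon-coefficients-vanish ((k , wk=1 , Wk=0) ∷ E) unique ps sum=0 =
    echelon-coefficients-vanish E unique
      (pivot-coefficient-vanishes wk=1 Wk=0 unique ps
        (trans (cong (λ u → lookup u k) sum=0) (lookup-replicate k 0ℚ)))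
      sum=0

  echelon-unique : ∀ {N} {W : Vec (Vec ℚ d) N} → Echelon W → VecUnique.Unique W
  echelon-unique [] = VecAllPairs.[]
  echelon-unique {W = w ∷ _} ((k , wk=1 , Wk=0) ∷ E) = VecAll.map w≢ Wk=0 VecAllPairs.∷ echelon-unique E
    where
      w≢ : ∀ {u} → lookup u k ≡ 0ℚ → ¬ w ≡ u
      w≢ uk=0 w≡u = ℚ.1≢0 (trans (sym wk=1) (trans (cong (λ u → lookup u k) w≡u) uk=0))

  echelon-basis : ∀ {N} {W : Vec (Vec ℚ d) N} (S : Vec ℚ d → Set) → Echelon W →
    (∀ v → S v ⇔ v ∈ W) → LinearlyIndependent S × HasCardinality S N
  echelon-basis {W = W} S E S⇔W = independent , (W , echelon-unique E , S⇔W)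
    where
      pair : ∀ {cs vs} → length cs ≡ length vs → All S vs →
        Pointwise (λ c v → c ≡ 0ℚ ⊎ v ∈ W) cs vs
      pair {[]} {[]} _ [] = []
      pair {_ ∷ _} {_ ∷ _} eq (s ∷ ss) =
        inj₂ (Equivalence.to (S⇔W _) s) ∷ pair (suc-injective eq) ss
      coefficients : ∀ {cs vs} → Pointwise (λ c _ → c ≡ 0ℚ) cs vs → All (_≡ 0ℚ) cs
      coefficients [] = []
      coefficients (c≡0 ∷ ps) = c≡0 ∷ coefficients ps
      independent : LinearlyIndependent S
      independent vs unique all-S cs eq sum=0 =
        coefficients (echelon-coefficients-vanish E unique (pair eq all-S) sum=0)

-- Coordinates of the vectors c_{i,j}

≡ᵇ-true : ∀ {x y} → x ≡ y → (x ≡ᵇ y) ≡ true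
≡ᵇ-true {x} {y} x≡y = Equivalence.to T-≡ (≡⇒≡ᵇ x y x≡y)

≡ᵇ-false : ∀ {x y} → x ≢ y → (x ≡ᵇ y) ≡ false
≡ᵇ-false {x} {y} x≢y with x ≡ᵇ y in eq
... | false = refl
... | true = ⊥-elim (x≢y (≡ᵇ⇒≡ x y (subst T (sym eq) tt)))

<ᵇ-true : ∀ {x y} → x < y → (x <ᵇ y) ≡ true
<ᵇ-true x<y = Equivalence.to T-≡ (<⇒<ᵇ x<y)

<ᵇ-false : ∀ {x y} → y ≤ x → (x <ᵇ y) ≡ false
<ᵇ-false {x} {y} y≤x with x <ᵇ y in eq
... | false = refl
... | true = ⊥-elim (<⇒≱ (<ᵇ⇒< x y (subst T (sym eq) tt)) y≤x)

record Indicator (n : ℕ) (P : ℕ → ℕ → Set) : Set where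
  field
    index : Fin (dim n)
    on : ∀ i j → P i (red n j) → lookup (c n i j) index ≡ 1ℚ
    off : ∀ i j → ¬ P i (red n j) → lookup (c n i j) index ≡ 0ℚ

module _ {n : ℕ} where

  coordinate : ∀ {k} → k ≤ 2 * n → Fin (dim n)
  coordinate k≤2n = fromℕ< (≤-<-trans k≤2n (m<m+n (2 * n) z<s))

  lookup-c : ∀ i j {k} (k≤2n : k ≤ 2 * n) →
    lookup (c n i j) (coordinate k≤2n) ≡ coord n i (red n j) k
  lookup-c i j k≤2n =
    trans (lookup∘tabulate (λ k → coord n i (red n j) (toℕ k)) (coordinate k≤2n))
          (cong (coord n i (red n j)) (toℕ-fromℕ< _))

  indicator : ∀ k (f g : ℕ → ℕ → ℕ) → k ≤ 2 * n →
    (∀ i j → coord n i j k ≡ ind (f i j ≡ᵇ g i j)) → Indicator n (λ i j → f i j ≡ g i j)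
  indicator k f g k≤2n coord≡ = record
    { index = coordinate k≤2n
    ; on = λ i j p → trans (value i j) (cong ind (≡ᵇ-true p))
    ; off = λ i j ¬p → trans (value i j) (cong ind (≡ᵇ-false ¬p))
    }
    where value = λ i j → trans (lookup-c i j k≤2n) (coord≡ i (red n j))

  row : ∀ {r} → 1 ≤ r → r ≤ n → Indicator n (λ i _ → r ≡ i)
  row {suc r} _ r<n = indicator r (λ _ _ → suc r) (λ i _ → i) r≤2n (λ _ _ → if-cong (<ᵇ-true r<n))
    where r≤2n = ≤-trans (<⇒≤ r<n) (m≤m+n n (n + 0))

  column : ∀ {s} → suc s < n → Indicator n (λ _ j → j ≡ suc s)
  column {s} s+1<n = indicator (n + s) (λ _ j → j) (λ _ _ → suc s) k≤2n λ i j →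
    trans (if-cong (<ᵇ-false (m≤m+n n s)))
          (trans (if-cong (<ᵇ-true k<2n-1)) (cong (λ x → ind (j ≡ᵇ x)) k+1-n≡s+1))
    where
      k+1-n≡s+1 : suc (n + s) ∸ n ≡ suc s
      k+1-n≡s+1 = trans (cong (_∸ n) (sym (+-suc n s))) (m+n∸m≡n n (suc s))
      k+2≤2n : suc (suc (n + s)) ≤ 2 * n
      k+2≤2n = subst₂ _≤_ n+[s+2]≡n+s+2 n+n≡2n (+-monoʳ-≤ n s+1<n)
        where
          n+[s+2]≡n+s+2 : n + suc (suc s) ≡ suc (suc (n + s))
          n+[s+2]≡n+s+2 = trans (+-suc n (suc s)) (cong suc (+-suc n s))
          n+n≡2n : n + n ≡ 2 * n
          n+n≡2n = cong (n +_) (sym (+-identityʳ n))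
      k<2n-1 : n + s < 2 * n ∸ 1
      k<2n-1 = ∸-monoˡ-≤ 1 k+2≤2n
      k≤2n : n + s ≤ 2 * n
      k≤2n = ≤-trans (n≤1+n _) (≤-trans (n≤1+n _) k+2≤2n)

diagonal : ∀ {n} → Indicator (suc n) (λ i j → i ≡ j)
diagonal {n} = indicator k (λ i _ → i) (λ _ j → j) (n≤1+n k) λ _ _ →
  trans (if-cong (<ᵇ-false n+1≤k))
        (trans (if-cong (<ᵇ-false (≤-refl {k}))) (if-cong (≡ᵇ-true (refl {x = k}))))
  where
    k = 2 * suc n ∸ 1
    n+1≤k : suc n ≤ k
    n+1≤k = subst (suc n ≤_) (sym (+-suc n (n + 0))) (s≤s (m≤m+n n (n + 0)))

antidiagonal : ∀ {n} → Indicator (suc n) (λ i j → i + j ≡ suc (suc n))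
antidiagonal {n} = indicator (2 * suc n) (λ i j → i + j) (λ _ _ → suc (suc n)) ≤-refl λ _ _ →
  trans (if-cong (<ᵇ-false (s≤s (m≤m+n n _))))
        (trans (if-cong (<ᵇ-false (n≤1+n k))) (if-cong (≡ᵇ-false (1+n≢n {k}))))
  where
    k = 2 * suc n ∸ 1

c-cong : ∀ n i j j′ → red n j ≡ red n j′ → c n i j ≡ c n i j′
c-cong n i _ _ eq = cong (λ r → tabulate (λ k → coord n i r (toℕ k))) eq

c-row-injective : ∀ {n i i′} j j′ → 1 ≤ i → i ≤ n → c n i j ≡ c n i′ j′ → i ≡ i′
c-row-injective {n} {i} {i′} j j′ 1≤i i≤n eq with i ≟ i′
... | yes i≡i′ = i≡i′
... | no i≢i′ = ⊥-elim (ℚ.1≢0 (begin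
  1ℚ                           ≡⟨ sym (on i j refl) ⟩
  lookup (c n i j) index       ≡⟨ cong (λ u → lookup u index) eq ⟩
  lookup (c n i′ j′) index     ≡⟨ off i′ j′ i≢i′ ⟩
  0ℚ                           ∎))
  where
    open Indicator (row {n} 1≤i i≤n)
    open ≡-Reasoning

-- Reduction modulo n

2*m+n≡m+[m+n] : ∀ m n → 2 * m + n ≡ m + (m + n)
2*m+n≡m+[m+n] m n = trans (cong (λ z → m + z + n) (+-identityʳ m)) (+-assoc m m n)

-- red (suc n) x is suc ((x ∸ 1) % suc n), so red (suc n) 0 is 1 rather than suc n: hence
-- the hypotheses 1 ≤ x below.
module _ {n : ℕ} where

  red-id : ∀ {x} → 1 ≤ x → x ≤ suc n → red (suc n) x ≡ x
  red-id {suc x} _ x<n+1 = cong suc (m≤n⇒m%n≡m (≤-pred x<n+1))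

  red-range : ∀ x → InRange (suc n) (red (suc n) x)
  red-range x = s≤s z≤n , m%n<n (x ∸ 1) (suc n)

  red-+ : ∀ {x} → 1 ≤ x → ∀ y → red (suc n) (red (suc n) x + y) ≡ red (suc n) (x + y)
  red-+ {suc x} _ y = cong suc (begin
    (x % suc n + y) % suc n                  ≡⟨ %-distribˡ-+ (x % suc n) y (suc n) ⟩
    (x % suc n % suc n + y % suc n) % suc n  ≡⟨ cong (λ z → (z + y % suc n) % suc n) (m%n%n≡m%n x (suc n)) ⟩
    (x % suc n + y % suc n) % suc n          ≡⟨ %-distribˡ-+ x y (suc n) ⟨
    (x + y) % suc n                          ∎)
    where open ≡-Reasoning

  red-periodic : ∀ {x} → 1 ≤ x → red (suc n) (x + suc n) ≡ red (suc n) x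
  red-periodic {suc x} _ = cong suc ([m+n]%n≡m%n x (suc n))

  red-wrap : ∀ {x} → 1 ≤ x → x ≤ suc n → red (suc n) (x + suc n) ≡ x
  red-wrap 1≤x x≤n = trans (red-periodic 1≤x) (red-id 1≤x x≤n)

  red-+N-injective : ∀ {j j′} → j < suc n → j′ < suc n →
    red (suc n) (j + suc n) ≡ red (suc n) (j′ + suc n) → j ≡ j′
  red-+N-injective {zero} {zero} _ _ _ = refl
  red-+N-injective {zero} {suc j′} _ j′<n eq =
    ⊥-elim (>⇒≢ j′<n (trans (sym (red-id (s≤s z≤n) ≤-refl)) (trans eq (red-wrap (s≤s z≤n) (<⇒≤ j′<n)))))
  red-+N-injective {suc j} {zero} j<n _ eq =
    ⊥-elim (>⇒≢ j<n (trans (sym (red-id (s≤s z≤n) ≤-refl)) (trans (sym eq) (red-wrap (s≤s z≤n) (<⇒≤ j<n)))))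
  red-+N-injective {suc j} {suc j′} j<n j′<n eq =
    trans (sym (red-wrap (s≤s z≤n) (<⇒≤ j<n))) (trans eq (red-wrap (s≤s z≤n) (<⇒≤ j′<n)))

  shift-cases : ∀ {i t} → 1 ≤ i → i ≤ suc n → t < suc n →
    (red (suc n) (i + t) ≡ i + t) ⊎ (∃ λ y → i + t ≡ y + suc n × red (suc n) (i + t) ≡ y)
  shift-cases {i} {t} 1≤i i≤n t<n with i + t ≤? suc n
  ... | yes i+t≤n = inj₁ (red-id (≤-trans 1≤i (m≤m+n i t)) i+t≤n)
  ... | no i+t≰n = inj₂ (y , sym y+n≡i+t , trans (cong (red (suc n)) (sym y+n≡i+t)) (red-wrap 1≤y y≤n))
    where
      y = i + t ∸ suc n
      n<i+t = ≰⇒> i+t≰n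
      y+n≡i+t : y + suc n ≡ i + t
      y+n≡i+t = m∸n+n≡m (<⇒≤ n<i+t)
      1≤y : 1 ≤ y
      1≤y = m<n⇒0<n∸m n<i+t
      y≤n : y ≤ suc n
      y≤n = +-cancelʳ-≤ (suc n) y (suc n)
              (subst (_≤ suc n + suc n) (sym y+n≡i+t) (+-mono-≤ i≤n (<⇒≤ t<n)))

  shift-no-fixed-point : ∀ {i t} → 1 ≤ i → i ≤ suc n → 0 < t → t < suc n → red (suc n) (i + t) ≢ i
  shift-no-fixed-point {i} {suc t} 1≤i i≤n _ t<n red≡i with shift-cases 1≤i i≤n t<n
  ... | inj₁ red≡i+t = m+1+n≢m i (trans (sym red≡i+t) red≡i)
  ... | inj₂ (y , i+t≡y+n , red≡y) =
    <⇒≢ t<n (+-cancelˡ-≡ i (suc t) (suc n) (trans i+t≡y+n (cong (_+ suc n) (trans (sym red≡y) red≡i))))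

  antidiagonal-shift : ∀ {i t} → 1 ≤ i → i ≤ suc n → t < suc n →
    i + red (suc n) (i + t) ≡ suc (suc n) → 2 * i + t ≡ suc (suc n) ⊎ 2 * i + t ≡ suc (2 * suc n)
  antidiagonal-shift {i} {t} 1≤i i≤n t<n sum≡ with shift-cases 1≤i i≤n t<n
  ... | inj₁ red≡i+t = inj₁ (begin
    2 * i + t                ≡⟨ 2*m+n≡m+[m+n] i t ⟩
    i + (i + t)              ≡⟨ cong (i +_) red≡i+t ⟨
    i + red (suc n) (i + t)  ≡⟨ sum≡ ⟩
    suc (suc n)              ∎)
    where open ≡-Reasoning
  ... | inj₂ (y , i+t≡y+n , red≡y) = inj₂ (begin
    2 * i + t                        ≡⟨ 2*m+n≡m+[m+n] i t ⟩
    i + (i + t)                      ≡⟨ cong (i +_) i+t≡y+n ⟩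
    i + (y + suc n)                  ≡⟨ +-assoc i y (suc n) ⟨
    i + y + suc n                    ≡⟨ cong (λ z → i + z + suc n) red≡y ⟨
    i + red (suc n) (i + t) + suc n  ≡⟨ cong (_+ suc n) sum≡ ⟩
    suc (suc n) + suc n              ≡⟨ cong suc (cong (suc n +_) (+-identityʳ (suc n))) ⟨
    suc (2 * suc n)                  ∎)
    where open ≡-Reasoning

OffDiagonals : ℕ → ℕ → ℕ → Set
OffDiagonals n i j = i ≢ j × i + j ≢ suc n

3+n*2≡2[1+n]+1 : ∀ n → suc (suc (suc (n * 2))) ≡ 2 * suc n + 1
3+n*2≡2[1+n]+1 = solve-∀

all-from-∈ : ∀ {A : Set} {P : A → Set} {N} {xs : Vec A N} →
  (∀ {x} → x ∈ xs → P x) → VecAll.All P xs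
all-from-∈ {xs = []} _ = VecAll.[]
all-from-∈ {xs = x ∷ xs} P∈ = P∈ (here refl) VecAll.∷ all-from-∈ (P∈ ∘ there)

-- The echelon list, column by column

-- The first vector of column j is written with column j + n, so that j = 0 stands for
-- column n, the only column without a coordinate of its own.
module Path {n : ℕ} (ρ : ℕ → ℕ) where

  path : (J : ℕ) → Vec (Vecn (suc n)) (suc (J * 2))
  path zero = c (suc n) (ρ zero) (zero + suc n) ∷ []
  path (suc j) = c (suc n) (ρ (suc j)) (suc j + suc n) ∷ c (suc n) (ρ j) (suc j) ∷ path j

  OnPath : ℕ → Vecn (suc n) → Set
  OnPath J v = (∃ λ j → j ≤ J × v ≡ c (suc n) (ρ j) (j + suc n))
             ⊎ (∃ λ j → j < J × v ≡ c (suc n) (ρ j) (suc j))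

  ∈-path⇔ : ∀ J {v} → v ∈ path J ⇔ OnPath J v
  ∈-path⇔ J = mk⇔ (to J) (from J)
    where
      to : ∀ J {v} → v ∈ path J → OnPath J v
      to zero (here eq) = inj₁ (zero , z≤n , eq)
      to (suc j) (here eq) = inj₁ (suc j , ≤-refl , eq)
      to (suc j) (there (here eq)) = inj₂ (j , ≤-refl , eq)
      to (suc j) (there (there v∈)) with to j v∈
      ... | inj₁ (j′ , j′≤j , eq) = inj₁ (j′ , m≤n⇒m≤1+n j′≤j , eq)
      ... | inj₂ (j′ , j′<j , eq) = inj₂ (j′ , m≤n⇒m≤1+n j′<j , eq)
      from : ∀ J {v} → OnPath J v → v ∈ path J
      from zero (inj₁ (zero , _ , eq)) = here eq
      from (suc j) (inj₁ (j′ , j′≤j+1 , eq)) with j′ ≟ suc j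
      ... | yes refl = here eq
      ... | no j′≢j+1 = there (there (from j (inj₁ (j′ , ≤-pred (≤∧≢⇒< j′≤j+1 j′≢j+1) , eq))))
      from (suc j) (inj₂ (j′ , j′<j+1 , eq)) with j′ ≟ j
      ... | yes refl = there (here eq)
      ... | no j′≢j = there (there (from j (inj₂ (j′ , ≤∧≢⇒< (≤-pred j′<j+1) j′≢j , eq))))

  path-off : ∀ {J P} (I : Indicator (suc n) P) →
    (∀ {j} → j ≤ J → ¬ P (ρ j) (red (suc n) (j + suc n))) →
    (∀ {j} → j < J → ¬ P (ρ j) (red (suc n) (suc j))) →
    VecAll.All (λ u → lookup u (Indicator.index I) ≡ 0ℚ) (path J)
  path-off {J} I off₁ off₂ = all-from-∈ λ v∈ → case Equivalence.to (∈-path⇔ J) v∈ of λ where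
    (inj₁ (j , j≤J , refl)) → Indicator.off I (ρ j) (j + suc n) (off₁ j≤J)
    (inj₂ (j , j<J , refl)) → Indicator.off I (ρ j) (suc j) (off₂ j<J)

  path-echelon : ∀ {J} → J ≤ n → (∀ {j j′} → j ≤ J → j′ ≤ J → ρ j ≡ ρ j′ → j ≡ j′) →
    (∀ {j} → j ≤ J → InRange (suc n) (ρ j)) → Echelon (path J)
  path-echelon {zero} _ _ ρ-range = (index , on (ρ zero) (suc n) refl , VecAll.[]) ∷ []
    where open Indicator (row (proj₁ (ρ-range z≤n)) (proj₂ (ρ-range z≤n)))
  path-echelon {suc j} j<n ρ-injective ρ-range = row-pivot ∷ column-pivot ∷
    path-echelon (<⇒≤ j<n) (λ p q → ρ-injective (m≤n⇒m≤1+n p) (m≤n⇒m≤1+n q)) (ρ-range ∘ m≤n⇒m≤1+n)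
    where
      ρ[j+1]≢ : ∀ {j′} → j′ ≤ j → ρ (suc j) ≢ ρ j′
      ρ[j+1]≢ j′≤j eq = 1+n≰n (subst (_≤ j) (sym (ρ-injective ≤-refl (m≤n⇒m≤1+n j′≤j) eq)) j′≤j)
      row-pivot : PivotOver (c (suc n) (ρ (suc j)) (suc j + suc n)) (c (suc n) (ρ j) (suc j) ∷ path j)
      row-pivot = index , on (ρ (suc j)) (suc j + suc n) refl ,
        off (ρ j) (suc j) (ρ[j+1]≢ ≤-refl) VecAll.∷ path-off R ρ[j+1]≢ (ρ[j+1]≢ ∘ <⇒≤)
        where
          R = row (proj₁ (ρ-range ≤-refl)) (proj₂ (ρ-range ≤-refl))
          open Indicator R
      column-pivot : PivotOver (c (suc n) (ρ j) (suc j)) (path j)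
      column-pivot = index , on (ρ j) (suc j) (red-id (s≤s z≤n) (m≤n⇒m≤1+n j<n)) ,
        path-off C wrapped-column earlier-column
        where
          C = column {suc n} (s≤s j<n)
          open Indicator C
          wrapped-column : ∀ {j′} → j′ ≤ j → red (suc n) (j′ + suc n) ≢ suc j
          wrapped-column {zero} _ eq = >⇒≢ (s≤s j<n) (trans (sym (red-id (s≤s z≤n) ≤-refl)) eq)
          wrapped-column {suc j′} j′≤j eq =
            1+n≰n (subst (_≤ j) (trans (sym (red-wrap (s≤s z≤n) (≤-trans j′≤j (m≤n⇒m≤1+n (<⇒≤ j<n))))) eq) j′≤j)
          earlier-column : ∀ {j′} → j′ < j → red (suc n) (suc j′) ≢ suc j
          earlier-column j′<j eq =
            <⇒≢ (s≤s j′<j) (trans (sym (red-id (s≤s z≤n) (s≤s (≤-trans (<⇒≤ j′<j) (<⇒≤ j<n))))) eq)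

  extended-echelon : ∀ {p q} → 1 ≤ p → p ≤ suc n → 1 ≤ q → q ≤ suc n → q ≢ suc (suc n) ∸ q →
    (∀ {j} → j ≤ n → OffDiagonals (suc n) (ρ j) (red (suc n) (j + suc n))) →
    (∀ {j} → j < n → OffDiagonals (suc n) (ρ j) (red (suc n) (suc j))) →
    Echelon (path n) → Echelon (c (suc n) p p ∷ c (suc n) q (suc (suc n) ∸ q) ∷ path n)
  extended-echelon {p} {suc q} 1≤p p≤n 1≤q q<n q≢ off₁ off₂ E = diagonal-pivot ∷ antidiagonal-pivot ∷ E
    where
      q′ = suc (suc n) ∸ suc q
      red-q′ : red (suc n) q′ ≡ q′
      red-q′ = red-id (m<n⇒0<n∸m (s≤s q<n)) (m∸n≤m (suc n) q)
      diagonal-pivot : PivotOver (c (suc n) p p) (c (suc n) (suc q) q′ ∷ path n)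
      diagonal-pivot = index , on p p (sym (red-id 1≤p p≤n)) ,
        off (suc q) q′ (λ eq → q≢ (trans eq red-q′)) VecAll.∷ path-off diagonal (proj₁ ∘ off₁) (proj₁ ∘ off₂)
        where open Indicator (diagonal {n})
      antidiagonal-pivot : PivotOver (c (suc n) (suc q) q′) (path n)
      antidiagonal-pivot =
        index , on (suc q) q′ (trans (cong (suc q +_) red-q′) (m+[n∸m]≡n (≤-trans q<n (n≤1+n _)))) ,
        path-off antidiagonal (proj₂ ∘ off₁) (proj₂ ∘ off₂)
        where open Indicator (antidiagonal {n})

-- Swapping two rows

swap : ℕ → ℕ → ℕ → ℕ
swap x y i = if i ≡ᵇ x then y else if i ≡ᵇ y then x else i

data SwapView (x y i : ℕ) : Set where
  left : i ≡ x → swap x y i ≡ y → SwapView x y i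
  right : i ≡ y → swap x y i ≡ x → SwapView x y i
  other : i ≢ x → i ≢ y → swap x y i ≡ i → SwapView x y i

swap-view : ∀ x y i → SwapView x y i
swap-view x y i with i ≟ x | i ≟ y
... | yes i≡x | _ = left i≡x (if-cong (≡ᵇ-true i≡x))
... | no i≢x | yes i≡y = right i≡y (trans (if-cong (≡ᵇ-false i≢x)) (if-cong (≡ᵇ-true i≡y)))
... | no i≢x | no i≢y = other i≢x i≢y (trans (if-cong (≡ᵇ-false i≢x)) (if-cong (≡ᵇ-false i≢y)))

swap-left : ∀ x y → swap x y x ≡ y
swap-left x y = if-cong (≡ᵇ-true (refl {x = x}))

swap-right : ∀ {x y} → x ≢ y → swap x y y ≡ x
swap-right {x} {y} x≢y = trans (if-cong (≡ᵇ-false (x≢y ∘ sym))) (if-cong (≡ᵇ-true (refl {x = y})))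

swap-fixed : ∀ {x y} i → i ≢ x → i ≢ y → swap x y i ≡ i
swap-fixed i i≢x i≢y = trans (if-cong (≡ᵇ-false i≢x)) (if-cong (≡ᵇ-false i≢y))

swap-involutive : ∀ {x y} → x ≢ y → ∀ i → swap x y (swap x y i) ≡ i
swap-involutive {x} {y} x≢y i with swap-view x y i
... | left refl s≡y = trans (cong (swap x y) s≡y) (swap-right x≢y)
... | right refl s≡x = trans (cong (swap x y) s≡x) (swap-left x y)
... | other _ _ s≡i = trans (cong (swap x y) s≡i) s≡i

swap-injective : ∀ {x y} → x ≢ y → ∀ {i i′} → swap x y i ≡ swap x y i′ → i ≡ i′
swap-injective {x} {y} x≢y {i} {i′} eq =
  trans (sym (swap-involutive x≢y i)) (trans (cong (swap x y) eq) (swap-involutive x≢y i′))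

swap-range : ∀ {n x y i} → InRange n x → InRange n y → InRange n i → InRange n (swap x y i)
swap-range {x = x} {y} {i} x∈ y∈ i∈ with swap-view x y i
... | left _ s≡y = subst (InRange _) (sym s≡y) y∈
... | right _ s≡x = subst (InRange _) (sym s≡x) x∈
... | other _ _ s≡i = subst (InRange _) (sym s≡i) i∈

-- 𝔅_ℓ with i₁, i₂, 2ℓ and n - 2ℓ - 1 abstracted to x₁, x₂, t and r.
SwapShape : (n x₁ x₂ t r : ℕ) → VSet n
SwapShape n x₁ x₂ t r v =
  (((∃ λ i → InRange n i × v ≡ c n i (i + t))
     ⊎ ((∃ λ i → InRange n i × v ≡ c n i (i + t + 1)) × v ≢ c n r n))
    × v ≢ c n x₁ (x₁ + t) × v ≢ c n x₁ (x₁ + t + 1)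
    × v ≢ c n x₂ (x₂ + t) × v ≢ c n x₂ (x₂ + t + 1))
  ⊎ (v ≡ c n x₁ (x₂ + t) ⊎ v ≡ c n x₁ (x₂ + t + 1) ⊎ v ≡ c n x₂ (x₁ + t) ⊎ v ≡ c n x₂ (x₁ + t + 1))

B≡SwapShape : ∀ n ℓ → B n ℓ ≡ SwapShape n (i₁ n ℓ) (i₂ n ℓ) (2 * ℓ) (n ∸ 2 * ℓ ∸ 1)
B≡SwapShape n ℓ = refl

SwapShape-cong : ∀ {n x₁ x₂ t r y₁ y₂ u s} → x₁ ≡ y₁ → x₂ ≡ y₂ → t ≡ u → r ≡ s →
  SwapShape n x₁ x₂ t r ≡ SwapShape n y₁ y₂ u s
SwapShape-cong refl refl refl refl = refl

SwapCells : (n x₁ x₂ t r : ℕ) → VSet n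
SwapCells n x₁ x₂ t r v = ∃ λ i → InRange n i ×
  (v ≡ c n (swap x₁ x₂ i) (i + t) ⊎ (v ≡ c n (swap x₁ x₂ i) (i + t + 1) × v ≢ c n r n))

module _ {n x₁ x₂ t r : ℕ} (x₁∈ : InRange n x₁) (x₂∈ : InRange n x₂) (x₁≢x₂ : x₁ ≢ x₂)
         (x₁≢r : x₁ ≢ r) (x₂≢r : x₂ ≢ r) where

  private
    rows-differ : ∀ {i x} j j′ → InRange n i → i ≢ x → c n i j ≢ c n x j′
    rows-differ j j′ (1≤i , i≤n) i≢x eq = i≢x (c-row-injective j j′ 1≤i i≤n eq)

  SwapShape⇔SwapCells : ∀ {v} → SwapShape n x₁ x₂ t r v ⇔ SwapCells n x₁ x₂ t r v
  SwapShape⇔SwapCells = mk⇔ to from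
    where
      unswapped : ∀ {i} (f : ℕ → ℕ) → c n i (f i) ≢ c n x₁ (f x₁) → c n i (f i) ≢ c n x₂ (f x₂) →
        c n i (f i) ≡ c n (swap x₁ x₂ i) (f i)
      unswapped {i} f ≢x₁ ≢x₂ = cong (λ z → c n z (f i))
        (sym (swap-fixed i (≢x₁ ∘ cong λ z → c n z (f z)) (≢x₂ ∘ cong λ z → c n z (f z))))
      swapped : ∀ i {y} j → swap x₁ x₂ i ≡ y → c n y j ≡ c n (swap x₁ x₂ i) j
      swapped _ j s≡y = cong (λ z → c n z j) (sym s≡y)
      to : ∀ {v} → SwapShape n x₁ x₂ t r v → SwapCells n x₁ x₂ t r v
      to (inj₁ (inj₁ (i , i∈ , refl) , ≢x₁ , _ , ≢x₂ , _)) = i , i∈ , inj₁ (unswapped {i} (_+ t) ≢x₁ ≢x₂)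
      to (inj₁ (inj₂ ((i , i∈ , refl) , ≢r) , _ , ≢x₁ , _ , ≢x₂)) =
        i , i∈ , inj₂ (unswapped {i} (λ z → z + t + 1) ≢x₁ ≢x₂ , ≢r)
      to (inj₂ (inj₁ refl)) = x₂ , x₂∈ , inj₁ (swapped x₂ (x₂ + t) (swap-right x₁≢x₂))
      to (inj₂ (inj₂ (inj₁ refl))) =
        x₂ , x₂∈ , inj₂ (swapped x₂ (x₂ + t + 1) (swap-right x₁≢x₂) , rows-differ (x₂ + t + 1) n x₁∈ x₁≢r)
      to (inj₂ (inj₂ (inj₂ (inj₁ refl)))) = x₁ , x₁∈ , inj₁ (swapped x₁ (x₁ + t) (swap-left x₁ x₂))
      to (inj₂ (inj₂ (inj₂ (inj₂ refl)))) =
        x₁ , x₁∈ , inj₂ (swapped x₁ (x₁ + t + 1) (swap-left x₁ x₂) , rows-differ (x₁ + t + 1) n x₂∈ x₂≢r)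
      from : ∀ {v} → SwapCells n x₁ x₂ t r v → SwapShape n x₁ x₂ t r v
      from (i , i∈ , cell) with swap-view x₁ x₂ i | cell
      ... | left refl s≡x₂ | inj₁ refl = inj₂ (inj₂ (inj₂ (inj₁ (sym (swapped x₁ (x₁ + t) s≡x₂)))))
      ... | left refl s≡x₂ | inj₂ (refl , _) = inj₂ (inj₂ (inj₂ (inj₂ (sym (swapped x₁ (x₁ + t + 1) s≡x₂)))))
      ... | right refl s≡x₁ | inj₁ refl = inj₂ (inj₁ (sym (swapped x₂ (x₂ + t) s≡x₁)))
      ... | right refl s≡x₁ | inj₂ (refl , _) = inj₂ (inj₂ (inj₁ (sym (swapped x₂ (x₂ + t + 1) s≡x₁))))
      ... | other i≢x₁ i≢x₂ s≡i | inj₁ refl = inj₁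
        ( inj₁ (i , i∈ , sym (swapped i (i + t) s≡i))
        , differ (x₁ + t) i≢x₁ , differ (x₁ + t + 1) i≢x₁ , differ (x₂ + t) i≢x₂ , differ (x₂ + t + 1) i≢x₂ )
        where
          differ : ∀ {x} j′ → i ≢ x → c n (swap x₁ x₂ i) (i + t) ≢ c n x j′
          differ j′ i≢x = rows-differ (i + t) j′ (swap-range x₁∈ x₂∈ i∈) (i≢x ∘ trans (sym s≡i))
      ... | other i≢x₁ i≢x₂ s≡i | inj₂ (refl , ≢r) = inj₁
        ( inj₂ ((i , i∈ , sym (swapped i (i + t + 1) s≡i)) , ≢r)
        , differ (x₁ + t) i≢x₁ , differ (x₁ + t + 1) i≢x₁ , differ (x₂ + t) i≢x₂ , differ (x₂ + t + 1) i≢x₂ )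
        where
          differ : ∀ {x} j′ → i ≢ x → c n (swap x₁ x₂ i) (i + t + 1) ≢ c n x j′
          differ j′ i≢x = rows-differ (i + t + 1) j′ (swap-range x₁∈ x₂∈ i∈) (i≢x ∘ trans (sym s≡i))

-- Rows are shifted cyclically against columns: column j holds row j + k (mod n), and
-- row i sits in column i + m (mod n); the two shifts are inverse since k + m = n.
module CyclicShift {n : ℕ} (k m : ℕ) (1≤k : 1 ≤ k) (k+m≡n : k + m ≡ suc n) where

  shiftRow : ℕ → ℕ
  shiftRow j = red (suc n) (j + k)

  shiftRow-range : ∀ j → InRange (suc n) (shiftRow j)
  shiftRow-range j = red-range (j + k)

  private
    1≤j+k : ∀ j → 1 ≤ j + k
    1≤j+k j = ≤-trans 1≤k (m≤n+m k j)

  shiftRow-column : ∀ j → red (suc n) (shiftRow j + m) ≡ red (suc n) (j + suc n)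
  shiftRow-column j = trans (red-+ (1≤j+k j) m) (cong (red (suc n)) (trans (+-assoc j k m) (cong (j +_) k+m≡n)))

  shiftRow-next-column : ∀ j → red (suc n) (shiftRow j + m + 1) ≡ red (suc n) (suc j)
  shiftRow-next-column j = begin
    red (suc n) (shiftRow j + m + 1)     ≡⟨ cong (red (suc n)) (+-assoc (shiftRow j) m 1) ⟩
    red (suc n) (shiftRow j + (m + 1))   ≡⟨ red-+ (1≤j+k j) (m + 1) ⟩
    red (suc n) (j + k + (m + 1))        ≡⟨ cong (red (suc n)) j+k+m+1≡j+1+n ⟩
    red (suc n) (suc j + suc n)          ≡⟨ red-periodic {n} {suc j} (s≤s z≤n) ⟩
    red (suc n) (suc j)                  ∎
    where
      open ≡-Reasoning
      j+k+m+1≡j+1+n : j + k + (m + 1) ≡ suc j + suc n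
      j+k+m+1≡j+1+n = begin
        j + k + (m + 1)    ≡⟨ +-assoc j k (m + 1) ⟩
        j + (k + (m + 1))  ≡⟨ cong (j +_) (+-assoc k m 1) ⟨
        j + (k + m + 1)    ≡⟨ cong (λ z → j + (z + 1)) k+m≡n ⟩
        j + (suc n + 1)    ≡⟨ cong (j +_) (+-comm (suc n) 1) ⟩
        j + suc (suc n)    ≡⟨ +-suc j (suc n) ⟩
        suc j + suc n      ∎

  shiftRow-injective : ∀ {j j′} → j < suc n → j′ < suc n → shiftRow j ≡ shiftRow j′ → j ≡ j′
  shiftRow-injective {j} {j′} j<n j′<n eq = red-+N-injective j<n j′<n
    (trans (sym (shiftRow-column j)) (trans (cong (λ z → red (suc n) (z + m)) eq) (shiftRow-column j′)))

  columnOf : ℕ → ℕ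
  columnOf i = red (suc n) (i + m)

  shiftRow-columnOf : ∀ {i} → InRange (suc n) i → shiftRow (columnOf i) ≡ i
  shiftRow-columnOf {i} (1≤i , i≤n) = begin
    red (suc n) (red (suc n) (i + m) + k)  ≡⟨ red-+ (≤-trans 1≤i (m≤m+n i m)) k ⟩
    red (suc n) (i + m + k)                 ≡⟨ cong (red (suc n)) i+m+k≡i+n ⟩
    red (suc n) (i + suc n)                 ≡⟨ red-wrap 1≤i i≤n ⟩
    i                                       ∎
    where
      open ≡-Reasoning
      i+m+k≡i+n : i + m + k ≡ i + suc n
      i+m+k≡i+n = trans (+-assoc i m k) (cong (i +_) (trans (+-comm m k) k+m≡n))

  shiftRow-surjective : ∀ {i} → InRange (suc n) i → ∃ λ j → j < suc n × shiftRow j ≡ i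
  shiftRow-surjective {i} i∈ with columnOf i ≟ suc n
  ... | no j≢n = columnOf i , ≤∧≢⇒< (proj₂ (red-range (i + m))) j≢n , shiftRow-columnOf i∈
  ... | yes j≡n = zero , s≤s z≤n , (begin
    red (suc n) k              ≡⟨ red-periodic 1≤k ⟨
    red (suc n) (k + suc n)    ≡⟨ cong (red (suc n)) (+-comm k (suc n)) ⟩
    shiftRow (suc n)           ≡⟨ cong shiftRow j≡n ⟨
    shiftRow (columnOf i)      ≡⟨ shiftRow-columnOf i∈ ⟩
    i                          ∎)
    where open ≡-Reasoning

  module _ {x₁ x₂ r : ℕ} (x₁∈ : InRange (suc n) x₁) (x₂∈ : InRange (suc n) x₂) (x₁≢x₂ : x₁ ≢ x₂)
           (x₁≢r : x₁ ≢ r) (x₂≢r : x₂ ≢ r) (last-row : shiftRow n ≡ r) where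

    ρ : ℕ → ℕ
    ρ = swap x₁ x₂ ∘ shiftRow

    open Path {n} ρ

    ρ-injective : ∀ {j j′} → j ≤ n → j′ ≤ n → ρ j ≡ ρ j′ → j ≡ j′
    ρ-injective j≤n j′≤n eq = shiftRow-injective (s≤s j≤n) (s≤s j′≤n) (swap-injective x₁≢x₂ eq)

    ρ-range : ∀ {j} → j ≤ n → InRange (suc n) (ρ j)
    ρ-range {j} _ = swap-range x₁∈ x₂∈ (shiftRow-range j)

    ρ-last : ρ n ≡ r
    ρ-last = trans (cong (swap x₁ x₂) last-row) (swap-fixed r (x₁≢r ∘ sym) (x₂≢r ∘ sym))

    private
      first-cell : ∀ j → c (suc n) (ρ j) (shiftRow j + m) ≡ c (suc n) (ρ j) (j + suc n)
      first-cell j = c-cong (suc n) (ρ j) (shiftRow j + m) (j + suc n) (shiftRow-column j)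
      second-cell : ∀ j → c (suc n) (ρ j) (shiftRow j + m + 1) ≡ c (suc n) (ρ j) (suc j)
      second-cell j = c-cong (suc n) (ρ j) (shiftRow j + m + 1) (suc j) (shiftRow-next-column j)

    SwapCells⇔OnPath : ∀ {v} → SwapCells (suc n) x₁ x₂ m r v ⇔ OnPath n v
    SwapCells⇔OnPath = mk⇔ to from
      where
        to : ∀ {v} → SwapCells (suc n) x₁ x₂ m r v → OnPath n v
        to (i , i∈ , cell) with shiftRow-surjective i∈ | cell
        ... | j , j<n+1 , refl | inj₁ refl = inj₁ (j , ≤-pred j<n+1 , first-cell j)
        ... | j , j<n+1 , refl | inj₂ (refl , ≢r) with j ≟ n
        ...   | yes refl = ⊥-elim (≢r (trans (second-cell n) (cong (λ z → c (suc n) z (suc n)) ρ-last)))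
        ...   | no j≢n = inj₂ (j , ≤∧≢⇒< (≤-pred j<n+1) j≢n , second-cell j)
        from : ∀ {v} → OnPath n v → SwapCells (suc n) x₁ x₂ m r v
        from (inj₁ (j , _ , refl)) = shiftRow j , shiftRow-range j , inj₁ (sym (first-cell j))
        from (inj₂ (j , j<n , refl)) = shiftRow j , shiftRow-range j , inj₂ (sym (second-cell j) , not-last)
          where
            not-last : c (suc n) (ρ j) (suc j) ≢ c (suc n) r (suc n)
            not-last eq = <⇒≢ j<n (ρ-injective (<⇒≤ j<n) ≤-refl (trans ρj≡r (sym ρ-last)))
              where
                ρj≡r = c-row-injective (suc j) (suc n) (proj₁ (ρ-range (<⇒≤ j<n))) (proj₂ (ρ-range (<⇒≤ j<n))) eq

    swap-shift-basis :
      (∀ {i} → InRange (suc n) i → OffDiagonals (suc n) (swap x₁ x₂ i) (red (suc n) (i + m))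
                                 × OffDiagonals (suc n) (swap x₁ x₂ i) (red (suc n) (i + m + 1))) →
      ∀ {a b} → S₁ (suc n) a → S₂ (suc n) b →
      let S = λ v → SwapShape (suc n) x₁ x₂ m r v ⊎ v ≡ a ⊎ v ≡ b
      in LinearlyIndependent S × HasCardinality S (2 * suc n + 1)
    swap-shift-basis off-diagonal {a} {b} (p , (1≤p , p≤n) , refl) ((q , (1≤q , q≤n) , refl) , b∉S₁) =
      subst (λ N → LinearlyIndependent S × HasCardinality S N) size (echelon-basis S echelon S⇔list)
      where
        S = λ v → SwapShape (suc n) x₁ x₂ m r v ⊎ v ≡ a ⊎ v ≡ b
        q≢q′ : q ≢ suc (suc n) ∸ q
        q≢q′ eq = b∉S₁ (q , (1≤q , q≤n) , cong (c (suc n) q) (sym eq))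
        echelon = extended-echelon 1≤p p≤n 1≤q q≤n q≢q′
          (λ {j} _ → subst (OffDiagonals (suc n) (ρ j)) (shiftRow-column j)
                           (proj₁ (off-diagonal (shiftRow-range j))))
          (λ {j} _ → subst (OffDiagonals (suc n) (ρ j)) (shiftRow-next-column j)
                           (proj₂ (off-diagonal (shiftRow-range j))))
          (path-echelon ≤-refl ρ-injective ρ-range)
        shape⇔cells = SwapShape⇔SwapCells x₁∈ x₂∈ x₁≢x₂ x₁≢r x₂≢r
        S⇔list : ∀ v → S v ⇔ v ∈ (c (suc n) p p ∷ b ∷ path n)
        S⇔list v = mk⇔ to from
          where
            to : S v → v ∈ (c (suc n) p p ∷ b ∷ path n)
            to (inj₁ shape) = there (there (Equivalence.from (∈-path⇔ n)
              (Equivalence.to SwapCells⇔OnPath (Equivalence.to shape⇔cells shape))))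
            to (inj₂ (inj₁ refl)) = here refl
            to (inj₂ (inj₂ refl)) = there (here refl)
            from : v ∈ (c (suc n) p p ∷ b ∷ path n) → S v
            from (here refl) = inj₂ (inj₁ refl)
            from (there (here refl)) = inj₂ (inj₂ refl)
            from (there (there v∈)) = inj₁ (Equivalence.from shape⇔cells
              (Equivalence.from SwapCells⇔OnPath (Equivalence.to (∈-path⇔ n) v∈)))
        size : suc (suc (suc (n * 2))) ≡ 2 * suc n + 1
        size = 3+n*2≡2[1+n]+1 n

-- The parameters of the corollary

≤-by : ∀ {x y} d → x + d ≡ y → x ≤ y
≤-by {x} d refl = m≤m+n x d

cancel-by : ∀ {x y} → x ≡ y → ∀ u v w → x ≡ u + w → y ≡ v + w → u ≡ v
cancel-by x≡y u v w x≡u+w y≡v+w = +-cancelʳ-≡ w u v (trans (sym x≡u+w) (trans x≡y y≡v+w))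

2*x+s≡2*y+1+e⇒x≡y+e : ∀ {x y s e} → s ≤ 1 → e ≤ 1 → 2 * x + s ≡ 2 * y + suc e → x ≡ y + e
2*x+s≡2*y+1+e⇒x≡y+e {x} {y} z≤n z≤n eq =
  ⊥-elim (even≢odd x y (trans (sym (+-identityʳ (2 * x))) (trans eq (+-comm (2 * y) 1))))
2*x+s≡2*y+1+e⇒x≡y+e {x} {y} z≤n (s≤s z≤n) eq = *-cancelˡ-≡ x (y + 1) 2 (begin
  2 * x         ≡⟨ +-identityʳ (2 * x) ⟨
  2 * x + 0     ≡⟨ eq ⟩
  2 * y + 2     ≡⟨ *-distribˡ-+ 2 y 1 ⟨
  2 * (y + 1)   ∎)
  where open ≡-Reasoning
2*x+s≡2*y+1+e⇒x≡y+e {x} {y} (s≤s z≤n) z≤n eq =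
  trans (*-cancelˡ-≡ x y 2 (+-cancelʳ-≡ 1 (2 * x) (2 * y) eq)) (sym (+-identityʳ y))
2*x+s≡2*y+1+e⇒x≡y+e {x} {y} (s≤s z≤n) (s≤s z≤n) eq = ⊥-elim (even≢odd (y + 1) x (begin
  2 * (y + 1)   ≡⟨ *-distribˡ-+ 2 y 1 ⟩
  2 * y + 2     ≡⟨ eq ⟨
  2 * x + 1     ≡⟨ +-comm (2 * x) 1 ⟩
  suc (2 * x)   ∎))
  where open ≡-Reasoning

half-of-rounded-up : ∀ {e} y → e ≤ 1 → (e + y * 2 + 1 ∸ ε (e + y * 2)) / 2 ≡ y + e
half-of-rounded-up y z≤n = begin
  (y * 2 + 1 ∸ ε (y * 2)) / 2   ≡⟨ cong (λ z → (y * 2 + 1 ∸ zero-flag z) / 2) (m*n%n≡0 y 2) ⟩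
  (y * 2 + 1 ∸ 1) / 2           ≡⟨ cong (_/ 2) (m+n∸n≡m (y * 2) 1) ⟩
  y * 2 / 2                     ≡⟨ m*n/n≡m y 2 ⟩
  y                             ≡⟨ +-identityʳ y ⟨
  y + 0                         ∎
  where
    open ≡-Reasoning
    zero-flag = λ r → if r ≡ᵇ 0 then 1 else 0
half-of-rounded-up y (s≤s z≤n) = begin
  (1 + y * 2 + 1 ∸ ε (1 + y * 2)) / 2   ≡⟨ cong (λ z → (1 + y * 2 + 1 ∸ zero-flag z) / 2) ([m+kn]%n≡m%n 1 y 2) ⟩
  (1 + y * 2 + 1) / 2                   ≡⟨ cong (_/ 2) (1+y*2+1≡[y+1]*2 y) ⟩
  (y + 1) * 2 / 2                       ≡⟨ m*n/n≡m (y + 1) 2 ⟩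
  y + 1                                 ∎
  where
    open ≡-Reasoning
    zero-flag = λ r → if r ≡ᵇ 0 then 1 else 0
    1+y*2+1≡[y+1]*2 : ∀ y → 1 + y * 2 + 1 ≡ (y + 1) * 2
    1+y*2+1≡[y+1]*2 = solve-∀

i₁-value : ∀ a b {e} → e ≤ 1 → i₁ (8 + 4 * a + 2 * b + e) (suc a) ≡ 3 + a + b + e
i₁-value a b {e} e≤1 = begin
  i₁ (8 + 4 * a + 2 * b + e) (suc a)           ≡⟨ cong (λ n → i₁ n (suc a)) (n≡e+y*2 a b e) ⟩
  i₁ (e + (4 + 2 * a + b) * 2) (suc a)         ≡⟨ cong (_∸ suc a) (half-of-rounded-up (4 + 2 * a + b) e≤1) ⟩
  4 + 2 * a + b + e ∸ suc a                    ≡⟨ cong (_∸ suc a) (y+e≡1+a+r₁ a b e) ⟩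
  suc a + (3 + a + b + e) ∸ suc a              ≡⟨ m+n∸m≡n (suc a) (3 + a + b + e) ⟩
  3 + a + b + e                                ∎
  where
    open ≡-Reasoning
    n≡e+y*2 : ∀ a b e → 8 + 4 * a + 2 * b + e ≡ e + (4 + 2 * a + b) * 2
    n≡e+y*2 = solve-∀
    y+e≡1+a+r₁ : ∀ a b e → 4 + 2 * a + b + e ≡ suc a + (3 + a + b + e)
    y+e≡1+a+r₁ = solve-∀

-- n = 8 + 4a + 2b + e and ℓ = a + 1; then m = 2ℓ, k = n - 2ℓ, r₁ = i₁, r₂ = i₂, and
-- r₀ = n - 2ℓ - 1 is the row of the vector missing from 𝔅̃_ℓ.
module Parameters (a b e : ℕ) (e≤1 : e ≤ 1) where

  -- Inlined, so that the ring solver sees the polynomials in a, b, e behind the names.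
  n : ℕ
  n = 8 + 4 * a + 2 * b + e
  m : ℕ
  m = 2 + 2 * a
  k : ℕ
  k = 6 + 2 * a + 2 * b + e
  r₁ : ℕ
  r₁ = 3 + a + b + e
  r₂ : ℕ
  r₂ = 7 + 3 * a + 2 * b + e
  r₀ : ℕ
  r₀ = 5 + 2 * a + 2 * b + e
  {-# INLINE n #-}
  {-# INLINE m #-}
  {-# INLINE k #-}
  {-# INLINE r₁ #-}
  {-# INLINE r₂ #-}
  {-# INLINE r₀ #-}

  abe : List ℕ
  abe = a ∷ b ∷ e ∷ []
  abe⁺⁺ : ℕ → ℕ → List ℕ
  abe⁺⁺ x y = x ∷ y ∷ abe

  antidiagonal-rows : ∀ {i} s → s ≤ 1 → 2 * i + (m + s) ≡ suc n ⊎ 2 * i + (m + s) ≡ suc (2 * n) → i ≡ r₁ ⊎ i ≡ r₂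
  antidiagonal-rows {i} s s≤1 (inj₁ eq) = inj₁ (2*x+s≡2*y+1+e⇒x≡y+e s≤1 e≤1
    (cancel-by eq (2 * i + s) (2 * (3 + a + b) + suc e) m (solve (abe⁺⁺ i s)) (solve abe)))
  antidiagonal-rows {i} s s≤1 (inj₂ eq) = inj₂ (trans (2*x+s≡2*y+1+e⇒x≡y+e s≤1 z≤n
    (cancel-by eq (2 * i + s) (2 * r₂ + 1) m (solve (abe⁺⁺ i s)) (solve abe))) (+-identityʳ r₂))

  r₁∈ : InRange n r₁
  r₁∈ = s≤s z≤n , ≤-by {r₁} {n} (5 + 3 * a + b) (solve abe)

  r₂∈ : InRange n r₂
  r₂∈ = s≤s z≤n , ≤-by {r₂} {n} (1 + a) (solve abe)

  r₀≤n : r₀ ≤ n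
  r₀≤n = ≤-by {r₀} {n} (3 + 2 * a) (solve abe)

  r₁≢r₂ : r₁ ≢ r₂
  r₁≢r₂ = <⇒≢ (≤-by {suc r₁} {r₂} (3 + 2 * a + b) (solve abe))

  r₁≢r₀ : r₁ ≢ r₀
  r₁≢r₀ = <⇒≢ (≤-by {suc r₁} {r₀} (1 + a + b) (solve abe))

  r₂≢r₀ : r₂ ≢ r₀
  r₂≢r₀ = >⇒≢ (≤-by {suc r₀} {r₂} (1 + a) (solve abe))

  k+m≡n : k + m ≡ n
  k+m≡n = solve abe

  open CyclicShift {7 + 4 * a + 2 * b + e} k m (s≤s z≤n) k+m≡n

  last-row : shiftRow (7 + 4 * a + 2 * b + e) ≡ r₀
  last-row = begin
    red n (7 + 4 * a + 2 * b + e + k)  ≡⟨ cong (red n) n-1+k≡r₀+n ⟩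
    red n (r₀ + n)                     ≡⟨ red-wrap (s≤s z≤n) r₀≤n ⟩
    r₀                                 ∎
    where
      open ≡-Reasoning
      n-1+k≡r₀+n : 7 + 4 * a + 2 * b + e + k ≡ r₀ + n
      n-1+k≡r₀+n = solve abe

  r₁-row-off-diagonal : ∀ s → s ≤ 1 → OffDiagonals n r₂ (red n (r₁ + m + s))
  r₁-row-off-diagonal s s≤1 =
    (λ eq → >⇒≢ below-r₂ (trans eq red≡)) , (λ eq → >⇒≢ above-n (trans (cong (r₂ +_) (sym red≡)) eq))
    where
      red≡ : red n (r₁ + m + s) ≡ r₁ + m + s
      red≡ = red-id (s≤s z≤n)
        (≤-trans (+-monoʳ-≤ (r₁ + m) s≤1) (≤-by {r₁ + m + 1} {n} (2 + a + b) (solve abe)))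
      below-r₂ : r₁ + m + s < r₂
      below-r₂ = ≤-<-trans (+-monoʳ-≤ (r₁ + m) s≤1) (≤-by {suc (r₁ + m + 1)} {r₂} b (solve abe))
      above-n : suc n < r₂ + (r₁ + m + s)
      above-n = ≤-trans (≤-by {suc (suc n)} {r₂ + (r₁ + m)} (2 + 2 * a + b + e) (solve abe))
                        (+-monoʳ-≤ r₂ (m≤m+n (r₁ + m) s))

  r₂-row-off-diagonal : ∀ s → s ≤ 1 → OffDiagonals n r₁ (red n (r₂ + m + s))
  r₂-row-off-diagonal s s≤1 =
    (λ eq → >⇒≢ above-column (trans eq red≡)) , (λ eq → <⇒≢ below-n (trans (cong (r₁ +_) (sym red≡)) eq))
    where
      wrapped : r₂ + m + s ≡ suc a + s + n
      wrapped = solve (abe⁺⁺ s s)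
      red≡ : red n (r₂ + m + s) ≡ suc a + s
      red≡ = trans (cong (red n) wrapped) (red-wrap (s≤s z≤n) (≤-trans (+-monoʳ-≤ (suc a) s≤1)
                   (≤-by {suc a + 1} {n} (6 + 3 * a + 2 * b + e) (solve abe))))
      above-column : suc a + s < r₁
      above-column = ≤-<-trans (+-monoʳ-≤ (suc a) s≤1) (≤-by {suc (suc a + 1)} {r₁} (b + e) (solve abe))
      below-n : r₁ + (suc a + s) < suc n
      below-n = ≤-<-trans (+-monoʳ-≤ r₁ (+-monoʳ-≤ (suc a) s≤1))
                          (≤-by {suc (r₁ + (suc a + 1))} {suc n} (3 + 2 * a + b) (solve abe))

  other-row-off-diagonal : ∀ {i} s → s ≤ 1 → InRange n i → i ≢ r₁ → i ≢ r₂ →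
    OffDiagonals n i (red n (i + m + s))
  other-row-off-diagonal {i} s s≤1 (1≤i , i≤n) i≢r₁ i≢r₂ =
    (λ eq → shift-no-fixed-point 1≤i i≤n (s≤s z≤n) m+s<n (trans (cong (red n) (sym assoc)) (sym eq))) ,
    (λ eq → [ i≢r₁ , i≢r₂ ]′ (antidiagonal-rows s s≤1
              (antidiagonal-shift 1≤i i≤n m+s<n (trans (cong (λ z → i + red n z) (sym assoc)) eq))))
    where
      assoc : i + m + s ≡ i + (m + s)
      assoc = +-assoc i m s
      m+s<n : m + s < n
      m+s<n = ≤-<-trans (+-monoʳ-≤ m s≤1) (≤-by {suc (m + 1)} {n} (4 + 2 * a + 2 * b + e) (solve abe))

  swap-shift-off-diagonal : ∀ {i} s → s ≤ 1 → InRange n i → OffDiagonals n (swap r₁ r₂ i) (red n (i + m + s))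
  swap-shift-off-diagonal {i} s s≤1 i∈ with swap-view r₁ r₂ i
  ... | left refl swap≡r₂ =
    subst (λ x → OffDiagonals n x (red n (r₁ + m + s))) (sym swap≡r₂) (r₁-row-off-diagonal s s≤1)
  ... | right refl swap≡r₁ =
    subst (λ x → OffDiagonals n x (red n (r₂ + m + s))) (sym swap≡r₁) (r₂-row-off-diagonal s s≤1)
  ... | other i≢r₁ i≢r₂ swap≡i =
    subst (λ x → OffDiagonals n x (red n (i + m + s))) (sym swap≡i) (other-row-off-diagonal s s≤1 i∈ i≢r₁ i≢r₂)

  B≡SwapShape-rows : B n (suc a) ≡ SwapShape n r₁ r₂ m r₀
  B≡SwapShape-rows = trans (B≡SwapShape n (suc a)) (SwapShape-cong (i₁-value a b e≤1) i₂-value 2ℓ≡m r₀-value)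
    where
      open ≡-Reasoning
      i₂-value : n ∸ suc a ≡ r₂
      i₂-value = begin
        n ∸ suc a          ≡⟨ cong (_∸ suc a) n≡ℓ+r₂ ⟩
        suc a + r₂ ∸ suc a ≡⟨ m+n∸m≡n (suc a) r₂ ⟩
        r₂                 ∎
        where
          n≡ℓ+r₂ : n ≡ suc a + r₂
          n≡ℓ+r₂ = solve abe
      2ℓ≡m : 2 * suc a ≡ m
      2ℓ≡m = solve abe
      r₀-value : n ∸ 2 * suc a ∸ 1 ≡ r₀
      r₀-value = begin
        n ∸ 2 * suc a ∸ 1                    ≡⟨ cong (λ z → z ∸ 2 * suc a ∸ 1) n≡2ℓ+r₀+1 ⟩
        2 * suc a + suc r₀ ∸ 2 * suc a ∸ 1   ≡⟨ cong (_∸ 1) (m+n∸m≡n (2 * suc a) (suc r₀)) ⟩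
        r₀                                   ∎
        where
          n≡2ℓ+r₀+1 : n ≡ 2 * suc a + suc r₀
          n≡2ℓ+r₀+1 = solve abe

  basis : ∀ {v w} → S₁ n v → S₂ n w →
    LinearlyIndependent (BUab n (suc a) v w) × HasCardinality (BUab n (suc a) v w) (2 * n + 1)
  basis {v} {w} S₁v S₂w =
    subst (λ S → LinearlyIndependent S × HasCardinality S (2 * n + 1))
          (cong (λ B′ u → B′ u ⊎ u ≡ v ⊎ u ≡ w) (sym B≡SwapShape-rows))
          (swap-shift-basis r₁∈ r₂∈ r₁≢r₂ r₁≢r₀ r₂≢r₀ last-row off-diagonal S₁v S₂w)
    where
      off-diagonal : ∀ {i} → InRange n i →
        OffDiagonals n (swap r₁ r₂ i) (red n (i + m)) × OffDiagonals n (swap r₁ r₂ i) (red n (i + m + 1))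
      off-diagonal {i} i∈ =
        subst (λ x → OffDiagonals n (swap r₁ r₂ i) (red n x)) (+-identityʳ (i + m))
              (swap-shift-off-diagonal 0 z≤n i∈) ,
        swap-shift-off-diagonal 1 (s≤s z≤n) i∈

1+m≤n∸1⇒2+m≤n : ∀ {m} n → suc m ≤ n ∸ 1 → suc (suc m) ≤ n
1+m≤n∸1⇒2+m≤n zero ()
1+m≤n∸1⇒2+m≤n (suc n) 1+m≤n = s≤s 1+m≤n

size-decomposition : ∀ n a → suc a ≤ n / 4 ∸ 1 → ∃ λ b → ∃ λ e → e ≤ 1 × n ≡ 8 + 4 * a + 2 * b + e
size-decomposition n a ℓ≤ = r / 2 , r % 2 , ≤-pred (m%n<n r 2) , (begin
  n                                    ≡⟨ sym 4[a+2]+r≡n ⟩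
  4 * (2 + a) + r                      ≡⟨ cong (4 * (2 + a) +_) (m≡m%n+[m/n]*n r 2) ⟩
  4 * (2 + a) + (r % 2 + r / 2 * 2)    ≡⟨ regroup a (r / 2) (r % 2) ⟩
  8 + 4 * a + 2 * (r / 2) + r % 2      ∎)
  where
    open ≡-Reasoning
    4[a+2]≤n : 4 * (2 + a) ≤ n
    4[a+2]≤n = ≤-trans (*-monoʳ-≤ 4 (1+m≤n∸1⇒2+m≤n (n / 4) ℓ≤))
                       (≤-trans (≤-reflexive (*-comm 4 (n / 4))) (m/n*n≤m n 4))
    r = n ∸ 4 * (2 + a)
    4[a+2]+r≡n : 4 * (2 + a) + r ≡ n
    4[a+2]+r≡n = m+[n∸m]≡n 4[a+2]≤n
    regroup : ∀ a y e → 4 * (2 + a) + (e + y * 2) ≡ 8 + 4 * a + 2 * y + e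
    regroup = solve-∀

-- The hypothesis 8 ≤ n is implied by 1 ≤ ℓ ≤ n / 4 - 1.
corollary6p5 : (n : ℕ) → 8 ≤ n → (ℓ : ℕ) → 1 ≤ ℓ → ℓ ≤ n / 4 ∸ 1 →
    (a b : Vecn n) → S₁ n a → S₂ n b →
    LinearlyIndependent (BUab n ℓ a b) × HasCardinality (BUab n ℓ a b) (2 * n + 1)
corollary6p5 n _ (suc ℓ-1) (s≤s z≤n) ℓ≤ _ _ S₁a S₂b with size-decomposition n ℓ-1 ℓ≤
... | q , e , e≤1 , refl = Parameters.basis ℓ-1 q e e≤1 S₁a S₂b
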